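{- Let $A_0,A_1,A_2,A_3$ be rational numbers satisfying $$A_3\neq 0,\qquad \frac{A_1}{A_3}-\frac{A_2^2}{3\,A_3^2}\neq 0,\qquad \frac{A_0}{A_3}-\frac{A_1\,A_2}{3\,A_3^2}+\frac{2\,A_2^3}{27\,A_3^3}\neq 0,$$ and set $$D=-\frac{(9\,A_1\,A_2\,A_3-27\,A_0\,A_3^2-2\,A_2^3)^2}{27\,(A_2^2-3\,A_1\,A_3)^3}.$$ Then the cubic equation $A_3\,x^3+A_2\,x^2+A_1\,x+A_0=0$ has three rational roots (counted with multiplicity) if and only if there is a rational number $w$ satisfying the sextic equation $$D\,(w^2+3)^3+4\,(w-1)^2\,(1+w)^2=0.$$ In this case the roots of the cubic equation are given by $$x_1=\frac{(2A_2^3-9A_1A_2A_3+27A_0A_3^2)\,w^2+(18A_1A_2A_3-6A_2^3)\,w-9A_1A_2A_3+81A_0A_3^2}{18\,A_3\,(A_2^2-3A_1A_3)\,(1+w)},$$ $$x_2=\frac{(2A_2^3-9A_1A_2A_3+27A_0A_3^2)\,w^2-(18A_1A_2A_3-6A_2^3)\,w-9A_1A_2A_3+81A_0A_3^2}{18\,A_3\,(A_2^2-3A_1A_3)\,(1-w)},$$ $$x_3=\frac{(A_2^3-27A_0A_3^2)\,w^2+36A_1A_2A_3-81A_0A_3^2-9A_2^3}{9\,A_3\,(A_2^2-3A_1A_3)\,(1-w)\,(1+w)}.$$ -}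

module Defs where

open import Data.Nat using (ℕ)
open import Data.Integer using (+_)
open import Data.Rational using (ℚ; 0ℚ; 1ℚ; _+_; _*_; _-_; -_; _÷_; _≟_; _/_; ≢-nonZero)
open import Data.Product using (∃; _,_)
open import Relation.Nullary using (yes; no)
open import Relation.Binary.PropositionalEquality using (_≡_)

#_ : ℕ → ℚ
# n = + n / 1

-- total division on ℚ (convention p ⊘ 0 = 0); all denominators used in the
-- statement are nonzero under its hypotheses, so the convention is never used.
infixl 7 _⊘_
_⊘_ : ℚ → ℚ → ℚ
p ⊘ q with q ≟ 0ℚ
... | yes _   = 0ℚ
... | no q≢0 = _÷_ p q {{≢-nonZero q≢0}}

cubic : ℚ → ℚ → ℚ → ℚ → ℚ → ℚ
cubic A0 A1 A2 A3 x = A3 * (x * x * x) + A2 * (x * x) + A1 * x + A0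

HasRoots : ℚ → ℚ → ℚ → ℚ → ℚ → ℚ → ℚ → Set
HasRoots A0 A1 A2 A3 x1 x2 x3 =
  ∀ x → cubic A0 A1 A2 A3 x ≡ A3 * (x - x1) * (x - x2) * (x - x3)

HasThreeRationalRoots : ℚ → ℚ → ℚ → ℚ → Set
HasThreeRationalRoots A0 A1 A2 A3 = ∃ λ x1 → ∃ λ x2 → ∃ λ x3 → HasRoots A0 A1 A2 A3 x1 x2 x3

pCoef : ℚ → ℚ → ℚ → ℚ → ℚ
pCoef A0 A1 A2 A3 = A1 ⊘ A3 - (A2 * A2) ⊘ (# 3 * (A3 * A3))

qCoef : ℚ → ℚ → ℚ → ℚ → ℚ
qCoef A0 A1 A2 A3 =
  A0 ⊘ A3 - (A1 * A2) ⊘ (# 3 * (A3 * A3)) + (# 2 * (A2 * A2 * A2)) ⊘ (# 27 * (A3 * A3 * A3))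

Dval : ℚ → ℚ → ℚ → ℚ → ℚ
Dval A0 A1 A2 A3 =
  - ((N * N) ⊘ (# 27 * (M * M * M)))
  where
    N = # 9 * A1 * A2 * A3 - # 27 * A0 * (A3 * A3) - # 2 * (A2 * A2 * A2)
    M = A2 * A2 - # 3 * A1 * A3

sextic : ℚ → ℚ → ℚ
sextic D w = D * (S * S * S) + # 4 * ((w - 1ℚ) * (w - 1ℚ)) * ((1ℚ + w) * (1ℚ + w))
  where S = w * w + # 3

root1 root2 root3 : ℚ → ℚ → ℚ → ℚ → ℚ → ℚ
root1 A0 A1 A2 A3 w =
  ((# 2 * (A2 * A2 * A2) - # 9 * A1 * A2 * A3 + # 27 * A0 * (A3 * A3)) * (w * w)
   + (# 18 * A1 * A2 * A3 - # 6 * (A2 * A2 * A2)) * w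
   - # 9 * A1 * A2 * A3 + # 81 * A0 * (A3 * A3))
  ⊘ (# 18 * A3 * (A2 * A2 - # 3 * A1 * A3) * (1ℚ + w))
root2 A0 A1 A2 A3 w =
  ((# 2 * (A2 * A2 * A2) - # 9 * A1 * A2 * A3 + # 27 * A0 * (A3 * A3)) * (w * w)
   - (# 18 * A1 * A2 * A3 - # 6 * (A2 * A2 * A2)) * w
   - # 9 * A1 * A2 * A3 + # 81 * A0 * (A3 * A3))
  ⊘ (# 18 * A3 * (A2 * A2 - # 3 * A1 * A3) * (1ℚ - w))
root3 A0 A1 A2 A3 w =
  ((A2 * A2 * A2 - # 27 * A0 * (A3 * A3)) * (w * w)
   + # 36 * A1 * A2 * A3 - # 81 * A0 * (A3 * A3) - # 9 * (A2 * A2 * A2))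
  ⊘ (# 9 * A3 * (A2 * A2 - # 3 * A1 * A3) * (1ℚ - w) * (1ℚ + w))

module Submission where

-- Shifting x by s = A₂/(3A₃) turns the cubic into A₃(y³ + p y + q), where p and q are the two
-- quantities assumed nonzero, and D = q²/p³; so the sextic vanishes exactly where the resolvent
-- q²(w² + 3)³ + 4p³(w² − 1)² does. If y³ + p y + q has rational roots u₁, u₂, u₃, then
-- u₁ + u₂ + u₃ = 0, u₃ ≠ 0 (as u₁u₂u₃ = −q), and w = (u₁ − u₂)/u₃ is a root of the resolvent: after
-- homogenising, the resolvent at p = σ₂, q = −σ₃ of (u₁, u₂, −u₁ − u₂) vanishes identically.
-- Conversely a rational root w is not ±1 (the resolvent is 64q² there), and then
-- −q(w² + 3)/(2p(1 + w)), −q(w² + 3)/(2p(1 − w)) and q(w² + 3)/(p(1 − w²)) are the three roots: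
-- multiplied by 2p(1 − w²) they become polynomials splitting the correspondingly rescaled cubic up to
-- a multiple of the resolvent. Shifting back by s gives the stated formulas.

open import Defs
open import Level using (0ℓ)
open import Data.Rational using (ℚ; 0ℚ; 1ℚ; _+_; _*_; _-_; -_; _≟_; 1/_; ≢-nonZero)
open import Data.Rational.Properties
  using (+-*-commutativeRing; +-0-group; *-assoc; *-identityʳ; *-inverseˡ; *-inverseʳ; *-zeroˡ; *-zeroʳ)
open import Algebra.Properties.Group +-0-group using (inverseˡ-unique; inverseʳ-unique; x∙y⁻¹≈ε⇒x≈y)
open import Data.Product using (_×_; ∃; _,_; -,_)
open import Data.List using (_∷_; [])
open import Relation.Nullary using (yes; no)
open import Relation.Nullary.Decidable using (dec⇒maybe)
open import Relation.Nullary.Negation using (contradiction)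
open import Relation.Binary.PropositionalEquality
  using (_≡_; _≢_; refl; sym; trans; cong; cong₂; module ≡-Reasoning)
open import Function.Bundles using (_⇔_; mk⇔; Equivalence)
open import Tactic.RingSolver using (solve; solve-∀)
open import Tactic.RingSolver.Core.AlmostCommutativeRing using (AlmostCommutativeRing; fromCommutativeRing)
open ≡-Reasoning

ℚ-ring : AlmostCommutativeRing 0ℓ 0ℓ
ℚ-ring = fromCommutativeRing +-*-commutativeRing (λ x → dec⇒maybe (0ℚ ≟ x))

*-cancelʳ-≡ : ∀ {x y c} → c ≢ 0ℚ → x * c ≡ y * c → x ≡ y
*-cancelʳ-≡ {x} {y} {c} c≢0 xc≡yc = begin
  x              ≡⟨ sym (x*c*c⁻¹≡x x) ⟩
  x * c * 1/ c   ≡⟨ cong (_* 1/ c) xc≡yc ⟩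
  y * c * 1/ c   ≡⟨ x*c*c⁻¹≡x y ⟩
  y              ∎
  where
  instance _ = ≢-nonZero c≢0
  x*c*c⁻¹≡x : ∀ x → x * c * 1/ c ≡ x
  x*c*c⁻¹≡x x = trans (*-assoc x c (1/ c)) (trans (cong (x *_) (*-inverseʳ c)) (*-identityʳ x))

*-≢0 : ∀ {x y} → x ≢ 0ℚ → y ≢ 0ℚ → x * y ≢ 0ℚ
*-≢0 {x} {y} x≢0 y≢0 xy≡0 = x≢0 (*-cancelʳ-≡ y≢0 (trans xy≡0 (sym (*-zeroˡ y))))

n⊘d*d≡n : ∀ n {d} → d ≢ 0ℚ → n ⊘ d * d ≡ n
n⊘d*d≡n n {d} d≢0 with d ≟ 0ℚ
... | yes d≡0 = contradiction d≡0 d≢0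
... | no d≢0′ = trans (*-assoc n (1/ d) d) (trans (cong (n *_) (*-inverseˡ d)) (*-identityʳ n))
  where
  instance _ = ≢-nonZero d≢0′

x*d≡n⇒n⊘d≡x : ∀ {x n d} → d ≢ 0ℚ → x * d ≡ n → n ⊘ d ≡ x
x*d≡n⇒n⊘d≡x {n = n} d≢0 x*d≡n = *-cancelʳ-≡ d≢0 (trans (n⊘d*d≡n n d≢0) (sym x*d≡n))

n⊘d*c≡n*k : ∀ {n d c k} → d ≢ 0ℚ → c ≡ d * k → n ⊘ d * c ≡ n * k
n⊘d*c≡n*k {n} {d} {c} {k} d≢0 refl = trans (sym (*-assoc (n ⊘ d) d k)) (cong (_* k) (n⊘d*d≡n n d≢0))

⊘-shift : ∀ {m e n d k s} → k ≢ 0ℚ → d ≢ 0ℚ → m ≡ k * (n - s * d) → e ≡ k * d → m ⊘ e ≡ n ⊘ d - s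
⊘-shift {n = n} {d} {k} {s} k≢0 d≢0 refl refl = x*d≡n⇒n⊘d≡x (*-≢0 k≢0 d≢0) (begin
  (n ⊘ d - s) * (k * d)      ≡⟨ distrib (n ⊘ d) ⟩
  k * (n ⊘ d * d - s * d)    ≡⟨ cong (λ m → k * (m - s * d)) (n⊘d*d≡n n d≢0) ⟩
  k * (n - s * d)            ∎)
  where
  distrib : ∀ x → (x - s) * (k * d) ≡ k * (x * d - s * d)
  distrib x = solve (x ∷ s ∷ k ∷ d ∷ []) ℚ-ring

quadratic≡0⇒coefficients≡0 : ∀ {a b c} → (∀ y → a * y * y + b * y + c ≡ 0ℚ) → a ≡ 0ℚ × b ≡ 0ℚ × c ≡ 0ℚ
quadratic≡0⇒coefficients≡0 {a} {b} {c} f≡0 = *-cancelʳ-≡ 2≢0 a*2≡0 , *-cancelʳ-≡ 2≢0 b*2≡0 , c≡0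
  where
  2≢0 : # 2 ≢ 0ℚ
  2≢0 ()
  c≡0 : c ≡ 0ℚ
  c≡0 = begin
    c                          ≡⟨ solve (a ∷ b ∷ c ∷ []) ℚ-ring ⟩
    a * 0ℚ * 0ℚ + b * 0ℚ + c   ≡⟨ f≡0 0ℚ ⟩
    0ℚ                         ∎
  a*2≡0 : a * # 2 ≡ 0ℚ * # 2
  a*2≡0 = begin
    a * # 2
      ≡⟨ solve (a ∷ b ∷ c ∷ []) ℚ-ring ⟩
    (a * 1ℚ * 1ℚ + b * 1ℚ + c) + (a * - 1ℚ * - 1ℚ + b * - 1ℚ + c) - # 2 * c
      ≡⟨ cong₂ (λ u v → u + v - # 2 * c) (f≡0 1ℚ) (f≡0 (- 1ℚ)) ⟩
    0ℚ + 0ℚ - # 2 * c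
      ≡⟨ cong (λ z → 0ℚ + 0ℚ - # 2 * z) c≡0 ⟩
    0ℚ * # 2 ∎
  b*2≡0 : b * # 2 ≡ 0ℚ * # 2
  b*2≡0 = begin
    b * # 2
      ≡⟨ solve (a ∷ b ∷ c ∷ []) ℚ-ring ⟩
    (a * 1ℚ * 1ℚ + b * 1ℚ + c) - (a * - 1ℚ * - 1ℚ + b * - 1ℚ + c)
      ≡⟨ cong₂ _-_ (f≡0 1ℚ) (f≡0 (- 1ℚ)) ⟩
    0ℚ * # 2 ∎

Splits : ℚ → ℚ → ℚ → ℚ → ℚ → Set
Splits p q u₁ u₂ u₃ = ∀ y → y * y * y + p * y + q ≡ (y - u₁) * (y - u₂) * (y - u₃)

splits⇒vieta : ∀ {p q u₁ u₂ u₃} → Splits p q u₁ u₂ u₃ →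
               u₃ ≡ - (u₁ + u₂) × p ≡ u₁ * u₂ + u₁ * u₃ + u₂ * u₃ × q ≡ - (u₁ * u₂ * u₃)
splits⇒vieta {p} {q} {u₁} {u₂} {u₃} split =
  let σ₁≡0 , p-σ₂≡0 , q+σ₃≡0 = quadratic≡0⇒coefficients≡0 difference≡0
  in inverseʳ-unique _ _ σ₁≡0 , x∙y⁻¹≈ε⇒x≈y _ _ p-σ₂≡0 , inverseˡ-unique _ _ q+σ₃≡0
  where
  difference≡0 : ∀ y →
    (u₁ + u₂ + u₃) * y * y + (p - (u₁ * u₂ + u₁ * u₃ + u₂ * u₃)) * y + (q + u₁ * u₂ * u₃) ≡ 0ℚ
  difference≡0 y = begin
    (u₁ + u₂ + u₃) * y * y + (p - (u₁ * u₂ + u₁ * u₃ + u₂ * u₃)) * y + (q + u₁ * u₂ * u₃)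
      ≡⟨ solve (p ∷ q ∷ u₁ ∷ u₂ ∷ u₃ ∷ y ∷ []) ℚ-ring ⟩
    (y * y * y + p * y + q) - (y - u₁) * (y - u₂) * (y - u₃)
      ≡⟨ cong (_- (y - u₁) * (y - u₂) * (y - u₃)) (split y) ⟩
    (y - u₁) * (y - u₂) * (y - u₃) - (y - u₁) * (y - u₂) * (y - u₃)
      ≡⟨ solve (u₁ ∷ u₂ ∷ u₃ ∷ y ∷ []) ℚ-ring ⟩
    0ℚ ∎

splits-unscale : ∀ {p q c u₁ u₂ u₃ v₁ v₂ v₃} → c ≢ 0ℚ → Splits (c * c * p) (c * c * c * q) v₁ v₂ v₃ →
                 u₁ * c ≡ v₁ → u₂ * c ≡ v₂ → u₃ * c ≡ v₃ → Splits p q u₁ u₂ u₃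
splits-unscale {p} {q} {c} {u₁} {u₂} {u₃} c≢0 split refl refl refl y = *-cancelʳ-≡ (*-≢0 (*-≢0 c≢0 c≢0) c≢0) (begin
  (y * y * y + p * y + q) * (c * c * c)                       ≡⟨ solve (p ∷ q ∷ c ∷ y ∷ []) ℚ-ring ⟩
  y * c * (y * c) * (y * c) + c * c * p * (y * c) + c * c * c * q ≡⟨ split (y * c) ⟩
  (y * c - u₁ * c) * (y * c - u₂ * c) * (y * c - u₃ * c)      ≡⟨ solve (c ∷ u₁ ∷ u₂ ∷ u₃ ∷ y ∷ []) ℚ-ring ⟩
  (y - u₁) * (y - u₂) * (y - u₃) * (c * c * c)                ∎)

-- Polynomial abbreviations are INLINE so that the ring solver sees through them.
resolvent : ℚ → ℚ → ℚ → ℚ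
resolvent p q w =
  q * q * ((w * w + # 3) * (w * w + # 3) * (w * w + # 3)) + # 4 * (p * p * p) * ((w - 1ℚ) * (w - 1ℚ)) * ((1ℚ + w) * (1ℚ + w))
{-# INLINE resolvent #-}

sextic≡0⇔resolvent≡0 : ∀ D p q w → p ≢ 0ℚ → D * (p * p * p) ≡ q * q → sextic D w ≡ 0ℚ ⇔ resolvent p q w ≡ 0ℚ
sextic≡0⇔resolvent≡0 D p q w p≢0 Dp³≡q² = mk⇔
  (λ sextic≡0 → trans (sym sextic*p³≡resolvent) (trans (cong (_* (p * p * p)) sextic≡0) (*-zeroˡ (p * p * p))))
  (λ R≡0 → *-cancelʳ-≡ (*-≢0 (*-≢0 p≢0 p≢0) p≢0)
             (trans sextic*p³≡resolvent (trans R≡0 (sym (*-zeroˡ (p * p * p))))))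
  where
  sextic*p³≡resolvent : sextic D w * (p * p * p) ≡ resolvent p q w
  sextic*p³≡resolvent =
    let S³ = (w * w + # 3) * (w * w + # 3) * (w * w + # 3)
        W₋ = (w - 1ℚ) * (w - 1ℚ)
        W₊ = (1ℚ + w) * (1ℚ + w)
    in begin
      (D * S³ + # 4 * W₋ * W₊) * (p * p * p)
        ≡⟨ solve (D ∷ p ∷ w ∷ []) ℚ-ring ⟩
      D * (p * p * p) * S³ + # 4 * (p * p * p) * W₋ * W₊
        ≡⟨ cong (λ x → x * S³ + # 4 * (p * p * p) * W₋ * W₊) Dp³≡q² ⟩
      resolvent p q w ∎

resolventʰ : ℚ → ℚ → ℚ → ℚ → ℚ
resolventʰ p q d t =
  q * q * ((d * d + # 3 * (t * t)) * (d * d + # 3 * (t * t)) * (d * d + # 3 * (t * t)))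
  + # 4 * (p * p * p) * ((d - t) * (d - t)) * ((t + d) * (t + d)) * (t * t)
{-# INLINE resolventʰ #-}

resolvent-homogeneous : ∀ p q w t → resolvent p q w * (t * t * t * t * t * t) ≡ resolventʰ p q (w * t) t
resolvent-homogeneous = solve-∀ ℚ-ring

resolventʰ-at-roots : ∀ u₁ u₂ → let u₃ = - (u₁ + u₂) in
                      resolventʰ (u₁ * u₂ + u₁ * u₃ + u₂ * u₃) (- (u₁ * u₂ * u₃)) (u₁ - u₂) u₃ ≡ 0ℚ
resolventʰ-at-roots = solve-∀ ℚ-ring

splits⇒resolvent≡0 : ∀ {p q u₁ u₂ u₃} → q ≢ 0ℚ → Splits p q u₁ u₂ u₃ →
                     resolvent p q ((u₁ - u₂) ⊘ u₃) ≡ 0ℚ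
splits⇒resolvent≡0 {p} {q} {u₁} {u₂} {u₃} q≢0 split =
  let u₃≡-[u₁+u₂] , p≡σ₂ , q≡-σ₃ = splits⇒vieta {p} {q} {u₁} {u₂} {u₃} split
      u₃≢0 : u₃ ≢ 0ℚ
      u₃≢0 u₃≡0 = q≢0 (trans q≡-σ₃ (trans (cong (λ t → - (u₁ * u₂ * t)) u₃≡0) (cong -_ (*-zeroʳ (u₁ * u₂)))))
      u₃⁶≢0 : u₃ * u₃ * u₃ * u₃ * u₃ * u₃ ≢ 0ℚ
      u₃⁶≢0 = *-≢0 (*-≢0 (*-≢0 (*-≢0 (*-≢0 u₃≢0 u₃≢0) u₃≢0) u₃≢0) u₃≢0) u₃≢0
      w = (u₁ - u₂) ⊘ u₃
  in *-cancelʳ-≡ u₃⁶≢0 (begin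
    resolvent p q w * (u₃ * u₃ * u₃ * u₃ * u₃ * u₃)
      ≡⟨ resolvent-homogeneous p q w u₃ ⟩
    resolventʰ p q (w * u₃) u₃
      ≡⟨ cong (λ d → resolventʰ p q d u₃) (n⊘d*d≡n (u₁ - u₂) u₃≢0) ⟩
    resolventʰ p q (u₁ - u₂) u₃
      ≡⟨ cong₂ (λ p q → resolventʰ p q (u₁ - u₂) u₃) p≡σ₂ q≡-σ₃ ⟩
    resolventʰ (u₁ * u₂ + u₁ * u₃ + u₂ * u₃) (- (u₁ * u₂ * u₃)) (u₁ - u₂) u₃
      ≡⟨ cong (λ t → resolventʰ (u₁ * u₂ + u₁ * t + u₂ * t) (- (u₁ * u₂ * t)) (u₁ - u₂) t) u₃≡-[u₁+u₂] ⟩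
    resolventʰ (u₁ * u₂ + u₁ * - (u₁ + u₂) + u₂ * - (u₁ + u₂)) (- (u₁ * u₂ * - (u₁ + u₂)))
               (u₁ - u₂) (- (u₁ + u₂))
      ≡⟨ resolventʰ-at-roots u₁ u₂ ⟩
    0ℚ
      ≡⟨ sym (*-zeroˡ (u₃ * u₃ * u₃ * u₃ * u₃ * u₃)) ⟩
    0ℚ * (u₃ * u₃ * u₃ * u₃ * u₃ * u₃) ∎)

resolvent≡0⇒1±w≢0 : ∀ {p q w} → q ≢ 0ℚ → resolvent p q w ≡ 0ℚ → 1ℚ + w ≢ 0ℚ × 1ℚ - w ≢ 0ℚ
resolvent≡0⇒1±w≢0 {p} {q} {w} q≢0 R≡0 =
  (λ 1+w≡0 → excluded (- 1ℚ) (solve (p ∷ q ∷ []) ℚ-ring) (inverseʳ-unique 1ℚ w 1+w≡0)) ,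
  (λ 1-w≡0 → excluded 1ℚ (solve (p ∷ q ∷ []) ℚ-ring) (sym (x∙y⁻¹≈ε⇒x≈y 1ℚ w 1-w≡0)))
  where
  64≢0 : # 64 ≢ 0ℚ
  64≢0 ()
  excluded : ∀ v → resolvent p q v ≡ # 64 * (q * q) → w ≢ v
  excluded v R[v]≡64q² refl = *-≢0 64≢0 (*-≢0 q≢0 q≢0) (trans (sym R[v]≡64q²) R≡0)

depressedRoot₁ depressedRoot₂ depressedRoot₃ : ℚ → ℚ → ℚ → ℚ
depressedRoot₁ p q w = - (q * (w * w + # 3)) ⊘ (# 2 * p * (1ℚ + w))
depressedRoot₂ p q w = - (q * (w * w + # 3)) ⊘ (# 2 * p * (1ℚ - w))
depressedRoot₃ p q w = q * (w * w + # 3) ⊘ (p * ((1ℚ - w) * (1ℚ + w)))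

-- The three roots are c times the depressed roots, with their denominators cleared.
resolvent≡0⇒scaled-splits : ∀ {p q w} → resolvent p q w ≡ 0ℚ →
  let c = # 2 * p * (1ℚ + w) * (1ℚ - w) ; n = q * (w * w + # 3) in
  Splits (c * c * p) (c * c * c * q) (- n * (1ℚ - w)) (- n * (1ℚ + w)) (n * # 2)
resolvent≡0⇒scaled-splits {p} {q} {w} R≡0 z =
  let c = # 2 * p * (1ℚ + w) * (1ℚ - w)
      n = q * (w * w + # 3)
      roots = (z - - n * (1ℚ - w)) * (z - - n * (1ℚ + w)) * (z - n * # 2)
      k = z + # 2 * q * ((1ℚ - w) * (1ℚ + w))
  in begin
    z * z * z + c * c * p * z + c * c * c * q ≡⟨ solve (p ∷ q ∷ w ∷ z ∷ []) ℚ-ring ⟩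
    roots + resolvent p q w * k               ≡⟨ cong (λ r → roots + r * k) R≡0 ⟩
    roots + 0ℚ * k                            ≡⟨ solve (q ∷ w ∷ z ∷ []) ℚ-ring ⟩
    roots                                     ∎

resolvent≡0⇒splits : ∀ {p q w} → p ≢ 0ℚ → q ≢ 0ℚ → resolvent p q w ≡ 0ℚ →
                     Splits p q (depressedRoot₁ p q w) (depressedRoot₂ p q w) (depressedRoot₃ p q w)
resolvent≡0⇒splits {p} {q} {w} p≢0 q≢0 R≡0 =
  let 1+w≢0 , 1-w≢0 = resolvent≡0⇒1±w≢0 {p} {q} {w} q≢0 R≡0
      2p≢0 : # 2 * p ≢ 0ℚ
      2p≢0 = *-≢0 2≢0 p≢0
  in splits-unscale (*-≢0 (*-≢0 2p≢0 1+w≢0) 1-w≢0) (resolvent≡0⇒scaled-splits {p} {q} {w} R≡0)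
       (n⊘d*c≡n*k (*-≢0 2p≢0 1+w≢0) refl)
       (n⊘d*c≡n*k (*-≢0 2p≢0 1-w≢0) c≡c₂*[1+w])
       (n⊘d*c≡n*k (*-≢0 p≢0 (*-≢0 1-w≢0 1+w≢0)) c≡c₃*2)
  where
  2≢0 : # 2 ≢ 0ℚ
  2≢0 ()
  c≡c₂*[1+w] : # 2 * p * (1ℚ + w) * (1ℚ - w) ≡ # 2 * p * (1ℚ - w) * (1ℚ + w)
  c≡c₂*[1+w] = solve (p ∷ w ∷ []) ℚ-ring
  c≡c₃*2 : # 2 * p * (1ℚ + w) * (1ℚ - w) ≡ p * ((1ℚ - w) * (1ℚ + w)) * # 2
  c≡c₃*2 = solve (p ∷ w ∷ []) ℚ-ring

depressed-coordinates : ∀ {A₀ A₁ A₂ a} s α γ → a ≢ 0ℚ → γ * a ≡ A₀ → α * a ≡ A₁ → s * (# 3 * a) ≡ A₂ →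
  let p = pCoef A₀ A₁ A₂ a ; q = qCoef A₀ A₁ A₂ a in
  A₀ ≡ a * (q + p * s + s * s * s) × A₁ ≡ a * (p + # 3 * (s * s)) × A₂ ≡ # 3 * a * s
depressed-coordinates {a = a} s α γ a≢0 refl refl refl =
  let p = pCoef (γ * a) (α * a) (s * (# 3 * a)) a
      q = qCoef (γ * a) (α * a) (s * (# 3 * a)) a
  in (begin
       γ * a
         ≡⟨ solve (a ∷ s ∷ α ∷ γ ∷ []) ℚ-ring ⟩
       a * ((γ - α * s + # 2 * (s * s * s)) + (α - # 3 * (s * s)) * s + s * s * s)
         ≡⟨ sym (cong₂ (λ p q → a * (q + p * s + s * s * s)) pCoef≡ qCoef≡) ⟩
       a * (q + p * s + s * s * s) ∎)
   , (begin
       α * a                                    ≡⟨ solve (a ∷ s ∷ α ∷ []) ℚ-ring ⟩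
       a * ((α - # 3 * (s * s)) + # 3 * (s * s)) ≡⟨ sym (cong (λ p → a * (p + # 3 * (s * s))) pCoef≡) ⟩
       a * (p + # 3 * (s * s))                  ∎)
   , solve (a ∷ s ∷ []) ℚ-ring
  where
  3a²≢0 : # 3 * (a * a) ≢ 0ℚ
  3a²≢0 = *-≢0 {# 3} (λ ()) (*-≢0 a≢0 a≢0)
  27a³≢0 : # 27 * (a * a * a) ≢ 0ℚ
  27a³≢0 = *-≢0 {# 27} (λ ()) (*-≢0 (*-≢0 a≢0 a≢0) a≢0)
  3s²*3a²≡A₂² : # 3 * (s * s) * (# 3 * (a * a)) ≡ s * (# 3 * a) * (s * (# 3 * a))
  3s²*3a²≡A₂² = solve (a ∷ s ∷ []) ℚ-ring
  αs*3a²≡A₁A₂ : α * s * (# 3 * (a * a)) ≡ α * a * (s * (# 3 * a))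
  αs*3a²≡A₁A₂ = solve (a ∷ s ∷ α ∷ []) ℚ-ring
  2s³*27a³≡2A₂³ : # 2 * (s * s * s) * (# 27 * (a * a * a)) ≡ # 2 * (s * (# 3 * a) * (s * (# 3 * a)) * (s * (# 3 * a)))
  2s³*27a³≡2A₂³ = solve (a ∷ s ∷ []) ℚ-ring
  pCoef≡ : pCoef (γ * a) (α * a) (s * (# 3 * a)) a ≡ α - # 3 * (s * s)
  pCoef≡ = cong₂ _-_ (x*d≡n⇒n⊘d≡x {α} a≢0 refl) (x*d≡n⇒n⊘d≡x 3a²≢0 3s²*3a²≡A₂²)
  qCoef≡ : qCoef (γ * a) (α * a) (s * (# 3 * a)) a ≡ γ - α * s + # 2 * (s * s * s)
  qCoef≡ = cong₂ _+_ (cong₂ _-_ (x*d≡n⇒n⊘d≡x {γ} a≢0 refl) (x*d≡n⇒n⊘d≡x 3a²≢0 αs*3a²≡A₁A₂))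
                     (x*d≡n⇒n⊘d≡x 27a³≢0 2s³*27a³≡2A₂³)

module DepressedCoordinates (a s p q : ℚ) where

  A₀ : ℚ
  A₀ = a * (q + p * s + s * s * s)
  {-# INLINE A₀ #-}

  A₁ : ℚ
  A₁ = a * (p + # 3 * (s * s))
  {-# INLINE A₁ #-}

  A₂ : ℚ
  A₂ = # 3 * a * s
  {-# INLINE A₂ #-}

  N : ℚ
  N = # 9 * A₁ * A₂ * a - # 27 * A₀ * (a * a) - # 2 * (A₂ * A₂ * A₂)
  {-# INLINE N #-}

  M : ℚ
  M = A₂ * A₂ - # 3 * A₁ * a
  {-# INLINE M #-}

  cubic-shift : ∀ x → cubic A₀ A₁ A₂ a x ≡ a * ((x + s) * (x + s) * (x + s) + p * (x + s) + q)
  cubic-shift x = begin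
    a * (x * x * x) + A₂ * (x * x) + A₁ * x + A₀        ≡⟨ solve (a ∷ s ∷ p ∷ q ∷ x ∷ []) ℚ-ring ⟩
    a * ((x + s) * (x + s) * (x + s) + p * (x + s) + q) ∎

  hasRoots⇒splits : a ≢ 0ℚ → ∀ {x₁ x₂ x₃} → HasRoots A₀ A₁ A₂ a x₁ x₂ x₃ →
                    Splits p q (x₁ + s) (x₂ + s) (x₃ + s)
  hasRoots⇒splits a≢0 {x₁} {x₂} {x₃} roots y = *-cancelʳ-≡ a≢0 (begin
    (y * y * y + p * y + q) * a
      ≡⟨ solve (a ∷ s ∷ p ∷ q ∷ y ∷ []) ℚ-ring ⟩
    a * ((y - s + s) * (y - s + s) * (y - s + s) + p * (y - s + s) + q)
      ≡⟨ sym (cubic-shift (y - s)) ⟩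
    cubic A₀ A₁ A₂ a (y - s)
      ≡⟨ roots (y - s) ⟩
    a * (y - s - x₁) * (y - s - x₂) * (y - s - x₃)
      ≡⟨ solve (a ∷ s ∷ x₁ ∷ x₂ ∷ x₃ ∷ y ∷ []) ℚ-ring ⟩
    (y - (x₁ + s)) * (y - (x₂ + s)) * (y - (x₃ + s)) * a ∎)

  splits⇒hasRoots : ∀ {u₁ u₂ u₃ x₁ x₂ x₃} → Splits p q u₁ u₂ u₃ →
                    x₁ ≡ u₁ - s → x₂ ≡ u₂ - s → x₃ ≡ u₃ - s → HasRoots A₀ A₁ A₂ a x₁ x₂ x₃
  splits⇒hasRoots {u₁} {u₂} {u₃} split refl refl refl x = begin
    cubic A₀ A₁ A₂ a x                                   ≡⟨ cubic-shift x ⟩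
    a * ((x + s) * (x + s) * (x + s) + p * (x + s) + q)  ≡⟨ cong (a *_) (split (x + s)) ⟩
    a * ((x + s - u₁) * (x + s - u₂) * (x + s - u₃))     ≡⟨ solve (a ∷ s ∷ u₁ ∷ u₂ ∷ u₃ ∷ x ∷ []) ℚ-ring ⟩
    a * (x - (u₁ - s)) * (x - (u₂ - s)) * (x - (u₃ - s)) ∎

  -27a³≢0 : a ≢ 0ℚ → - # 27 * (a * a * a) ≢ 0ℚ
  -27a³≢0 a≢0 = *-≢0 {x = - # 27} (λ ()) (*-≢0 (*-≢0 a≢0 a≢0) a≢0)

  Dval*p³≡q² : a ≢ 0ℚ → p ≢ 0ℚ → Dval A₀ A₁ A₂ a * (p * p * p) ≡ q * q
  Dval*p³≡q² a≢0 p≢0 = *-cancelʳ-≡ 729a⁶≢0 (scaled {N * N ⊘ (# 27 * (M * M * M))} (n⊘d*d≡n (N * N) 27M³≢0))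
    where
    a⁶≢0 : a * a * a * a * a * a ≢ 0ℚ
    a⁶≢0 = *-≢0 (*-≢0 (*-≢0 (*-≢0 (*-≢0 a≢0 a≢0) a≢0) a≢0) a≢0) a≢0
    729a⁶≢0 : # 729 * (a * a * a * a * a * a) ≢ 0ℚ
    729a⁶≢0 = *-≢0 {# 729} (λ ()) a⁶≢0
    27M³≡ : - # 729 * (a * a * a * a * a * a) * (p * p * p) ≡ # 27 * (M * M * M)
    27M³≡ = solve (a ∷ s ∷ p ∷ []) ℚ-ring
    27M³≢0 : # 27 * (M * M * M) ≢ 0ℚ
    27M³≢0 e = *-≢0 (*-≢0 {x = - # 729} (λ ()) a⁶≢0) (*-≢0 (*-≢0 p≢0 p≢0) p≢0) (trans 27M³≡ e)
    scaled : ∀ {X} → X * (# 27 * (M * M * M)) ≡ N * N →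
             - X * (p * p * p) * (# 729 * (a * a * a * a * a * a)) ≡ q * q * (# 729 * (a * a * a * a * a * a))
    scaled {X} e = begin
      - X * (p * p * p) * (# 729 * (a * a * a * a * a * a)) ≡⟨ solve (X ∷ a ∷ s ∷ p ∷ []) ℚ-ring ⟩
      X * (# 27 * (M * M * M))                              ≡⟨ e ⟩
      N * N                                                 ≡⟨ solve (a ∷ s ∷ p ∷ q ∷ []) ℚ-ring ⟩
      q * q * (# 729 * (a * a * a * a * a * a))             ∎

  root₁-shift : a ≢ 0ℚ → ∀ w → # 2 * p * (1ℚ + w) ≢ 0ℚ → root1 A₀ A₁ A₂ a w ≡ depressedRoot₁ p q w - s
  root₁-shift a≢0 w d≢0 = ⊘-shift (-27a³≢0 a≢0) d≢0 numerator denominator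
    where
    numerator : (# 2 * (A₂ * A₂ * A₂) - # 9 * A₁ * A₂ * a + # 27 * A₀ * (a * a)) * (w * w)
                + (# 18 * A₁ * A₂ * a - # 6 * (A₂ * A₂ * A₂)) * w - # 9 * A₁ * A₂ * a + # 81 * A₀ * (a * a)
                ≡ - # 27 * (a * a * a) * (- (q * (w * w + # 3)) - s * (# 2 * p * (1ℚ + w)))
    numerator = solve (a ∷ s ∷ p ∷ q ∷ w ∷ []) ℚ-ring
    denominator : # 18 * a * M * (1ℚ + w) ≡ - # 27 * (a * a * a) * (# 2 * p * (1ℚ + w))
    denominator = solve (a ∷ s ∷ p ∷ w ∷ []) ℚ-ring

  root₂-shift : a ≢ 0ℚ → ∀ w → # 2 * p * (1ℚ - w) ≢ 0ℚ → root2 A₀ A₁ A₂ a w ≡ depressedRoot₂ p q w - s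
  root₂-shift a≢0 w d≢0 = ⊘-shift (-27a³≢0 a≢0) d≢0 numerator denominator
    where
    numerator : (# 2 * (A₂ * A₂ * A₂) - # 9 * A₁ * A₂ * a + # 27 * A₀ * (a * a)) * (w * w)
                - (# 18 * A₁ * A₂ * a - # 6 * (A₂ * A₂ * A₂)) * w - # 9 * A₁ * A₂ * a + # 81 * A₀ * (a * a)
                ≡ - # 27 * (a * a * a) * (- (q * (w * w + # 3)) - s * (# 2 * p * (1ℚ - w)))
    numerator = solve (a ∷ s ∷ p ∷ q ∷ w ∷ []) ℚ-ring
    denominator : # 18 * a * M * (1ℚ - w) ≡ - # 27 * (a * a * a) * (# 2 * p * (1ℚ - w))
    denominator = solve (a ∷ s ∷ p ∷ w ∷ []) ℚ-ring

  root₃-shift : a ≢ 0ℚ → ∀ w → p * ((1ℚ - w) * (1ℚ + w)) ≢ 0ℚ → root3 A₀ A₁ A₂ a w ≡ depressedRoot₃ p q w - s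
  root₃-shift a≢0 w d≢0 = ⊘-shift (-27a³≢0 a≢0) d≢0 numerator denominator
    where
    numerator : (A₂ * A₂ * A₂ - # 27 * A₀ * (a * a)) * (w * w)
                + # 36 * A₁ * A₂ * a - # 81 * A₀ * (a * a) - # 9 * (A₂ * A₂ * A₂)
                ≡ - # 27 * (a * a * a) * (q * (w * w + # 3) - s * (p * ((1ℚ - w) * (1ℚ + w))))
    numerator = solve (a ∷ s ∷ p ∷ q ∷ w ∷ []) ℚ-ring
    denominator : # 9 * a * M * (1ℚ - w) * (1ℚ + w) ≡ - # 27 * (a * a * a) * (p * ((1ℚ - w) * (1ℚ + w)))
    denominator = solve (a ∷ s ∷ p ∷ w ∷ []) ℚ-ring

  roots⇒sextic-root : a ≢ 0ℚ → p ≢ 0ℚ → q ≢ 0ℚ → HasThreeRationalRoots A₀ A₁ A₂ a →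
                      ∃ λ w → sextic (Dval A₀ A₁ A₂ a) w ≡ 0ℚ
  roots⇒sextic-root a≢0 p≢0 q≢0 (x₁ , x₂ , x₃ , roots) =
    let u₁ = x₁ + s ; u₂ = x₂ + s ; u₃ = x₃ + s ; w = (u₁ - u₂) ⊘ u₃
    in w , Equivalence.from (sextic≡0⇔resolvent≡0 (Dval A₀ A₁ A₂ a) p q w p≢0 (Dval*p³≡q² a≢0 p≢0))
             (splits⇒resolvent≡0 {p} {q} {u₁} {u₂} {u₃} q≢0 (hasRoots⇒splits a≢0 roots))

  sextic-root⇒roots : a ≢ 0ℚ → p ≢ 0ℚ → q ≢ 0ℚ → ∀ w → sextic (Dval A₀ A₁ A₂ a) w ≡ 0ℚ →
                      HasRoots A₀ A₁ A₂ a (root1 A₀ A₁ A₂ a w) (root2 A₀ A₁ A₂ a w) (root3 A₀ A₁ A₂ a w)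
  sextic-root⇒roots a≢0 p≢0 q≢0 w sextic≡0 =
    let R≡0 = Equivalence.to (sextic≡0⇔resolvent≡0 (Dval A₀ A₁ A₂ a) p q w p≢0 (Dval*p³≡q² a≢0 p≢0)) sextic≡0
        1+w≢0 , 1-w≢0 = resolvent≡0⇒1±w≢0 {p} {q} {w} q≢0 R≡0
        2p≢0 : # 2 * p ≢ 0ℚ
        2p≢0 = *-≢0 {# 2} (λ ()) p≢0
    in splits⇒hasRoots (resolvent≡0⇒splits {p} {q} {w} p≢0 q≢0 R≡0)
         (root₁-shift a≢0 w (*-≢0 2p≢0 1+w≢0))
         (root₂-shift a≢0 w (*-≢0 2p≢0 1-w≢0))
         (root₃-shift a≢0 w (*-≢0 p≢0 (*-≢0 1-w≢0 1+w≢0)))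

  -- Stated for B's merely equal to A₀ A₁ A₂: in lemma2p2 the parameters s, p, q are themselves
  -- computed from the coefficients, so the coefficients can only be rewritten, not substituted.
  criterion : ∀ {B₀ B₁ B₂} → a ≢ 0ℚ → p ≢ 0ℚ → q ≢ 0ℚ → B₀ ≡ A₀ × B₁ ≡ A₁ × B₂ ≡ A₂ →
              (HasThreeRationalRoots B₀ B₁ B₂ a ⇔ ∃ λ w → sextic (Dval B₀ B₁ B₂ a) w ≡ 0ℚ)
              × (∀ w → sextic (Dval B₀ B₁ B₂ a) w ≡ 0ℚ →
                   HasRoots B₀ B₁ B₂ a (root1 B₀ B₁ B₂ a w) (root2 B₀ B₁ B₂ a w) (root3 B₀ B₁ B₂ a w))
  criterion a≢0 p≢0 q≢0 (refl , refl , refl) =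
    mk⇔ (roots⇒sextic-root a≢0 p≢0 q≢0)
        (λ (w , sextic≡0) → -, -, -, sextic-root⇒roots a≢0 p≢0 q≢0 w sextic≡0)
    , sextic-root⇒roots a≢0 p≢0 q≢0

lemma2p2 : (A0 A1 A2 A3 : ℚ) →
           A3 ≢ 0ℚ →
           pCoef A0 A1 A2 A3 ≢ 0ℚ →
           qCoef A0 A1 A2 A3 ≢ 0ℚ →
           (HasThreeRationalRoots A0 A1 A2 A3
              ⇔ ∃ (λ w → sextic (Dval A0 A1 A2 A3) w ≡ 0ℚ))
           × (∀ w → sextic (Dval A0 A1 A2 A3) w ≡ 0ℚ →
                HasRoots A0 A1 A2 A3 (root1 A0 A1 A2 A3 w) (root2 A0 A1 A2 A3 w) (root3 A0 A1 A2 A3 w))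
lemma2p2 A0 A1 A2 A3 A3≢0 p≢0 q≢0 =
  criterion A3≢0 p≢0 q≢0
    (depressed-coordinates (A2 ⊘ (# 3 * A3)) (A1 ⊘ A3) (A0 ⊘ A3) A3≢0
      (n⊘d*d≡n A0 A3≢0) (n⊘d*d≡n A1 A3≢0) (n⊘d*d≡n A2 (*-≢0 {# 3} (λ ()) A3≢0)))
  where
  open DepressedCoordinates A3 (A2 ⊘ (# 3 * A3)) (pCoef A0 A1 A2 A3) (qCoef A0 A1 A2 A3)
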